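{- For every finite strict double poset $d$, $$\mathrm{proj}\big(\Phi_{\mathrm{regmono}\leftarrow\mathrm{mor}}(d)\big)=\sum_{\sigma\in\mathfrak S}|\mathrm{Epi}(d,\iota(\sigma))|\,\iota(\sigma).$$
   Context: A finite strict double poset is a triple $(A,P_A,Q_A)$ with $A$ finite and $P_A,Q_A$ strict partial orders; morphisms are maps preserving both strict orders, forming a category; $\mathrm{Epi}$ denotes epimorphisms and $\mathrm{Aut}$ automorphisms. $V=\bigoplus_n\mathbb Q[\mathsf{DP}(n)]$ is the free $\mathbb Q$-vector space on isomorphism classes of finite strict double posets, and $\Phi_{\mathrm{regmono}\leftarrow\mathrm{mor}}:V\to V$ is the linear map with $\Phi_{\mathrm{regmono}\leftarrow\mathrm{mor}}(d)=\sum_{d'}\frac{|\mathrm{Epi}(d,d')|}{|\mathrm{Aut}(d')|}d'$ (sum over isomorphism classes). $\mathfrak S=\bigcup_n\mathfrak S(n)$ is the set of all permutations; for $\sigma\in\mathfrak S(n)$, $\iota(\sigma)=([n],\{(i,j):i<j\},\{(i,j):\sigma(i)<\sigma(j)\})$. $\mathrm{proj}:V\to V$ is the linear map with $\mathrm{proj}(d)=d$ if $d$ is (the class of) $\iota(\sigma)$ for some $\sigma\in\mathfrak S$, and $\mathrm{proj}(d)=0$ otherwise. -}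

module Defs where

open import Data.Nat using (ℕ; zero; suc)
open import Data.Integer using (+_)
open import Data.Fin using (Fin) renaming (_<_ to _<ᶠ_)
open import Data.Fin.Properties using (<-irrefl; <-trans)
open import Data.Vec using (Vec; lookup; map; allFin)
open import Data.List using (List; length)
open import Data.List.Membership.Propositional using (_∈_)
open import Data.List.Relation.Unary.Unique.Propositional using (Unique)
open import Data.Product using (Σ; Σ-syntax; ∃; _×_; _,_)
open import Data.Rational using (ℚ; _/_; 0ℚ)
open import Function.Bundles using (_⇔_)
open import Relation.Nullary using (¬_)
open import Relation.Binary.PropositionalEquality using (_≡_; refl)

-- Finite strict double posets, with carrier Fin n (every finite strict
-- double poset is isomorphic to one of these).

record DP (n : ℕ) : Set₁ where
  field
    P Q     : Fin n → Fin n → Set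
    P-irrefl : ∀ i → ¬ P i i
    P-trans  : ∀ {i j l} → P i j → P j l → P i l
    Q-irrefl : ∀ i → ¬ Q i i
    Q-trans  : ∀ {i j l} → Q i j → Q j l → Q i l
open DP public

-- Maps Fin m → Fin k are represented as vectors (decidable equality).
_∘ᵥ_ : ∀ {m k n} → Vec (Fin n) k → Vec (Fin k) m → Vec (Fin n) m
g ∘ᵥ f = map (lookup g) f

idᵥ : ∀ n → Vec (Fin n) n
idᵥ n = allFin n

IsMor : ∀ {m k} → DP m → DP k → Vec (Fin k) m → Set
IsMor d e f =
  (∀ i j → P d i j → P e (lookup f i) (lookup f j)) ×
  (∀ i j → Q d i j → Q e (lookup f i) (lookup f j))

IsEpi : ∀ {m k} → DP m → DP k → Vec (Fin k) m → Set₁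
IsEpi {m} {k} d d' f =
  ∀ {n} (e : DP n) (g h : Vec (Fin n) k) →
  IsMor d' e g → IsMor d' e h → g ∘ᵥ f ≡ h ∘ᵥ f → g ≡ h

Epi : ∀ {m k} → DP m → DP k → Vec (Fin k) m → Set₁
Epi d d' f = IsMor d d' f × IsEpi d d' f

IsIso : ∀ {m k} → DP m → DP k → Vec (Fin k) m → Set
IsIso {m} {k} d e f = IsMor d e f ×
  Σ[ g ∈ Vec (Fin m) k ] (IsMor e d g × (g ∘ᵥ f ≡ idᵥ m) × (f ∘ᵥ g ≡ idᵥ k))

Aut : ∀ {k} → DP k → Vec (Fin k) k → Set
Aut d f = IsIso d d f

_≅_ : ∀ {m k} → DP m → DP k → Set
d ≅ e = ∃ λ f → IsIso d e f

Enumerates : ∀ {a p} {A : Set a} → List A → (A → Set p) → Set _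
Enumerates L P = Unique L × (∀ x → (x ∈ L) ⇔ P x)

Card : ∀ {a p} {A : Set a} → (A → Set p) → ℕ → Set _
Card {A = A} P n = Σ[ L ∈ List A ] (Enumerates L P × length L ≡ n)

-- an element of 𝔖 = ⋃ₙ 𝔖(n): a size n and a map [n] → [n] (as vector)
Perm : Set
Perm = Σ ℕ λ n → Vec (Fin n) n

IsPerm : Perm → Set
IsPerm (n , σ) = Σ[ τ ∈ Vec (Fin n) n ] ((τ ∘ᵥ σ ≡ idᵥ n) × (σ ∘ᵥ τ ≡ idᵥ n))

ι : ∀ {n} → Vec (Fin n) n → DP n
ι σ = record
  { P = λ i j → i <ᶠ j
  ; Q = λ i j → lookup σ i <ᶠ lookup σ j
  ; P-irrefl = λ i → <-irrefl refl
  ; P-trans = <-trans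
  ; Q-irrefl = λ i → <-irrefl refl
  ; Q-trans = <-trans
  }

IsPermClass : ∀ {k} → DP k → Set
IsPermClass d' = Σ[ s ∈ Perm ] (IsPerm s × (ι (Data.Product.proj₂ s) ≅ d'))

-- a / b for natural numbers (b ≠ 0 in all uses; b = 0 ↦ 0 by convention)
divℕ : ℕ → ℕ → ℚ
divℕ a zero    = 0ℚ
divℕ a (suc b) = + a / suc b

fromℕ : ℕ → ℚ
fromℕ a = + a / 1

-- ProjCoeff d' x y : if the vector v ∈ V has coefficient x at the basis
-- element [d'], then proj(v) has coefficient y at [d'].
ProjCoeff : ∀ {k} → DP k → ℚ → ℚ → Set
ProjCoeff d' x y = (IsPermClass d' → y ≡ x) × (¬ IsPermClass d' → y ≡ 0ℚ)

-- Counting automorphisms is already enough to decide any proposition X: in the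
-- three-point double poset with 0 <P 2, and 0 <P 1 exactly when X, the
-- transposition of 1 and 2 is an automorphism iff X.  So we may split on whether
-- d' is the class of some ι σ₀.  If it is not, both sides vanish.  If it
-- is, an isomorphism between ι σ and ι τ is strictly monotone with a strictly
-- monotone inverse, hence the identity; therefore σ₀ is unique (a permutation is
-- determined by the order it induces), d' is rigid (|Aut d'| = 1), and
-- |Epi(d, ι σ₀)| = |Epi(d, d')|.

module Submission where

open import Defs
open import Level using (Level)
open import Data.Nat using (ℕ; _+_; _≤_; _<_; z≤n; s≤s)
open import Data.Nat.Properties using (≤-trans; ≤-antisym; +-identityʳ)
open import Data.Nat.ListAction using (sum)
open import Data.Fin using (Fin; toℕ; inject₁) renaming (zero to fzero; suc to fsuc; _<_ to _<ᶠ_)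
open import Data.Fin.Properties using (toℕ-injective; toℕ-inject₁; ≤̄⇒inject₁<; injective⇒≤; _≟_)
import Data.Fin.Properties as Fin
open import Data.Vec using (Vec; lookup; []; _∷_)
open import Data.Vec.Properties using (lookup-map; lookup-allFin; map-∘; map-cong; map-id; map-lookup-allFin; ≡-dec)
open import Data.Vec.Relation.Binary.Pointwise.Extensional using (ext; Pointwise-≡⇒≡)
open import Data.List using (List; length; map; []; _∷_)
import Data.List as List
open import Data.List.Membership.Propositional using (_∈_)
open import Data.List.Membership.Propositional.Properties using (∈-lookup)
import Data.List.Membership.DecPropositional as DecMembership
open import Data.List.Relation.Unary.Any using (here; there; index)
open import Data.List.Relation.Unary.Any.Properties using (lookup-index)
import Data.List.Relation.Unary.All as All
open import Data.List.Relation.Unary.AllPairs using ([]; _∷_)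
open import Data.List.Relation.Unary.Unique.Propositional using (Unique)
open import Data.Product using (Σ-syntax; _×_; _,_; proj₁; proj₂)
open import Data.Unit using (⊤; tt)
open import Data.Empty using (⊥; ⊥-elim)
open import Function using (_∘_)
open import Function.Bundles using (_⇔_; mk⇔; Equivalence)
open import Function.Construct.Composition using (_⇔-∘_)
open import Function.Definitions using (Injective)
open import Relation.Binary.Core using (_Preserves_⟶_)
open import Relation.Nullary using (Dec; yes; no)
import Relation.Nullary.Decidable as Dec
open import Relation.Binary.PropositionalEquality

private
  variable
    a b ℓ ℓ′ : Level
    m n k l : ℕ

lookup-∘ᵥ : (g : Vec (Fin l) k) (f : Vec (Fin k) m) (i : Fin m) →
            lookup (g ∘ᵥ f) i ≡ lookup g (lookup f i)
lookup-∘ᵥ g f i = lookup-map i (lookup g) f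

lookup-ext : {A : Set a} {u v : Vec A n} → (∀ i → lookup u i ≡ lookup v i) → u ≡ v
lookup-ext p = Pointwise-≡⇒≡ (ext p)

∘ᵥ-assoc : (h : Vec (Fin n) l) (g : Vec (Fin l) k) (f : Vec (Fin k) m) →
           (h ∘ᵥ g) ∘ᵥ f ≡ h ∘ᵥ (g ∘ᵥ f)
∘ᵥ-assoc h g f = trans (map-cong (λ i → lookup-∘ᵥ h g i) f) (map-∘ (lookup h) (lookup g) f)

∘ᵥ-identityˡ : (f : Vec (Fin k) m) → idᵥ k ∘ᵥ f ≡ f
∘ᵥ-identityˡ f = trans (map-cong lookup-allFin f) (map-id f)

∘ᵥ-identityʳ : (f : Vec (Fin k) m) → f ∘ᵥ idᵥ m ≡ f
∘ᵥ-identityʳ = map-lookup-allFin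

∘ᵥ-inverse : (g : Vec (Fin m) k) (f : Vec (Fin k) m) → g ∘ᵥ f ≡ idᵥ m →
             ∀ i → lookup g (lookup f i) ≡ i
∘ᵥ-inverse g f gf i =
  trans (sym (lookup-∘ᵥ g f i)) (trans (cong (λ v → lookup v i) gf) (lookup-allFin i))

∘ᵥ-inverse⇒injective : (g : Vec (Fin m) k) (f : Vec (Fin k) m) → g ∘ᵥ f ≡ idᵥ m →
                       Injective _≡_ _≡_ (lookup f)
∘ᵥ-inverse⇒injective g f gf {i} {j} eq =
  trans (sym (∘ᵥ-inverse g f gf i)) (trans (cong (lookup g) eq) (∘ᵥ-inverse g f gf j))

∘ᵥ-inverse-∘ : (u : Vec (Fin m) k) (v : Vec (Fin k) l) (w : Vec (Fin l) k) (x : Vec (Fin k) m) →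
               v ∘ᵥ w ≡ idᵥ k → u ∘ᵥ x ≡ idᵥ m → (u ∘ᵥ v) ∘ᵥ (w ∘ᵥ x) ≡ idᵥ m
∘ᵥ-inverse-∘ u v w x vw ux = begin
  (u ∘ᵥ v) ∘ᵥ (w ∘ᵥ x)  ≡⟨ ∘ᵥ-assoc u v (w ∘ᵥ x) ⟩
  u ∘ᵥ (v ∘ᵥ (w ∘ᵥ x))  ≡⟨ cong (u ∘ᵥ_) (sym (∘ᵥ-assoc v w x)) ⟩
  u ∘ᵥ ((v ∘ᵥ w) ∘ᵥ x)  ≡⟨ cong (λ y → u ∘ᵥ (y ∘ᵥ x)) vw ⟩
  u ∘ᵥ (idᵥ _ ∘ᵥ x)     ≡⟨ cong (u ∘ᵥ_) (∘ᵥ-identityˡ x) ⟩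
  u ∘ᵥ x                ≡⟨ ux ⟩
  idᵥ _                 ∎
  where open ≡-Reasoning

∘ᵥ-cancelˡ : (h : Vec (Fin n) k) (h' : Vec (Fin k) n) → h' ∘ᵥ h ≡ idᵥ k →
             {e e' : Vec (Fin k) m} → h ∘ᵥ e ≡ h ∘ᵥ e' → e ≡ e'
∘ᵥ-cancelˡ h h' h'h {e} {e'} eq = begin
  e                ≡⟨ sym (∘ᵥ-identityˡ e) ⟩
  idᵥ _ ∘ᵥ e       ≡⟨ cong (_∘ᵥ e) (sym h'h) ⟩
  (h' ∘ᵥ h) ∘ᵥ e   ≡⟨ ∘ᵥ-assoc h' h e ⟩
  h' ∘ᵥ (h ∘ᵥ e)   ≡⟨ cong (h' ∘ᵥ_) eq ⟩
  h' ∘ᵥ (h ∘ᵥ e')  ≡⟨ sym (∘ᵥ-assoc h' h e') ⟩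
  (h' ∘ᵥ h) ∘ᵥ e'  ≡⟨ cong (_∘ᵥ e') h'h ⟩
  idᵥ _ ∘ᵥ e'      ≡⟨ ∘ᵥ-identityˡ e' ⟩
  e'               ∎
  where open ≡-Reasoning

∘ᵥ-cancelʳ : (h : Vec (Fin k) m) (h' : Vec (Fin m) k) → h ∘ᵥ h' ≡ idᵥ k →
             {g g' : Vec (Fin n) k} → g ∘ᵥ h ≡ g' ∘ᵥ h → g ≡ g'
∘ᵥ-cancelʳ h h' hh' {g} {g'} eq = begin
  g                ≡⟨ sym (∘ᵥ-identityʳ g) ⟩
  g ∘ᵥ idᵥ _       ≡⟨ cong (g ∘ᵥ_) (sym hh') ⟩
  g ∘ᵥ (h ∘ᵥ h')   ≡⟨ sym (∘ᵥ-assoc g h h') ⟩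
  (g ∘ᵥ h) ∘ᵥ h'   ≡⟨ cong (_∘ᵥ h') eq ⟩
  (g' ∘ᵥ h) ∘ᵥ h'  ≡⟨ ∘ᵥ-assoc g' h h' ⟩
  g' ∘ᵥ (h ∘ᵥ h')  ≡⟨ cong (g' ∘ᵥ_) hh' ⟩
  g' ∘ᵥ idᵥ _      ≡⟨ ∘ᵥ-identityʳ g' ⟩
  g'               ∎
  where open ≡-Reasoning

toℕ≤-<-mono : {f : Fin m → Fin n} → f Preserves _<ᶠ_ ⟶ _<ᶠ_ → ∀ i → toℕ i ≤ toℕ (f i)
toℕ≤-<-mono f-mono fzero = z≤n
toℕ≤-<-mono f-mono (fsuc i) =
  ≤-trans (s≤s (toℕ≤-<-mono (f-mono ∘ inject₁-mono) i)) (f-mono (≤̄⇒inject₁< (Fin.≤-refl {x = i})))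
  where
  inject₁-mono : ∀ {i j} → i <ᶠ j → inject₁ i <ᶠ inject₁ j
  inject₁-mono {i} {j} = subst₂ _<_ (sym (toℕ-inject₁ i)) (sym (toℕ-inject₁ j))

<-mono-section⇒≗id : {f g : Fin n → Fin n} →
                     f Preserves _<ᶠ_ ⟶ _<ᶠ_ → g Preserves _<ᶠ_ ⟶ _<ᶠ_ →
                     (∀ i → g (f i) ≡ i) → ∀ i → f i ≡ i
<-mono-section⇒≗id {f = f} f-mono g-mono gf i = toℕ-injective (≤-antisym
  (subst (λ j → toℕ (f i) ≤ toℕ j) (gf i) (toℕ≤-<-mono g-mono (f i)))
  (toℕ≤-<-mono f-mono i))

Unique⇒lookup-injective : {A : Set a} {xs : List A} → Unique xs → Injective _≡_ _≡_ (List.lookup xs)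
Unique⇒lookup-injective (_ ∷ _)    {fzero}  {fzero}  _  = refl
Unique⇒lookup-injective (x∉ ∷ _)   {fzero}  {fsuc j} eq = ⊥-elim (All.lookup x∉ (∈-lookup j) eq)
Unique⇒lookup-injective (x∉ ∷ _)   {fsuc i} {fzero}  eq = ⊥-elim (All.lookup x∉ (∈-lookup i) (sym eq))
Unique⇒lookup-injective (_ ∷ uniq) {fsuc i} {fsuc j} eq = cong fsuc (Unique⇒lookup-injective uniq eq)

Card-injection⇒≤ : {A : Set a} {B : Set b} {R : A → Set ℓ} {S : B → Set ℓ′} → Card R m → Card S n →
                   (φ : A → B) → Injective _≡_ _≡_ φ → (∀ {x} → R x → S (φ x)) → m ≤ n
Card-injection⇒≤ (xs , (xs-unique , xs-enum) , refl) (ys , (_ , ys-enum) , refl) φ φ-injective φ-maps =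
  injective⇒≤ position-injective
  where
  φ∈ys : ∀ i → φ (List.lookup xs i) ∈ ys
  φ∈ys i = Equivalence.from (ys-enum _) (φ-maps (Equivalence.to (xs-enum _) (∈-lookup i)))
  position : Fin (length xs) → Fin (length ys)
  position i = index (φ∈ys i)
  position-injective : Injective _≡_ _≡_ position
  position-injective {i} {j} eq = Unique⇒lookup-injective xs-unique (φ-injective
    (trans (lookup-index (φ∈ys i)) (trans (cong (List.lookup ys) eq) (sym (lookup-index (φ∈ys j))))))

Card-singleton : {A : Set a} {R : A → Set ℓ} {x₀ : A} → Card R n → R x₀ → (∀ {x} → R x → x ≡ x₀) → n ≡ 1
Card-singleton ([] , (_ , enum) , refl) Rx₀ _ with () ← Equivalence.from (enum _) Rx₀
Card-singleton (_ ∷ [] , _ , refl) _ _ = refl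
Card-singleton (_ ∷ _ ∷ _ , ((x≢y All.∷ _) ∷ _ , enum) , refl) _ only =
  ⊥-elim (x≢y (trans (only (Equivalence.to (enum _) (here refl)))
                     (sym (only (Equivalence.to (enum _) (there (here refl)))))))

IsMor-∘ : {d : DP m} {e : DP k} {c : DP l} (g : Vec (Fin l) k) (f : Vec (Fin k) m) →
          IsMor e c g → IsMor d e f → IsMor d c (g ∘ᵥ f)
IsMor-∘ {c = c} g f (gP , gQ) (fP , fQ) =
  (λ i j p → subst₂ (P c) (sym (lookup-∘ᵥ g f i)) (sym (lookup-∘ᵥ g f j)) (gP _ _ (fP i j p))) ,
  (λ i j q → subst₂ (Q c) (sym (lookup-∘ᵥ g f i)) (sym (lookup-∘ᵥ g f j)) (gQ _ _ (fQ i j q)))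

IsIso-∘ : {d : DP m} {e : DP k} {c : DP l} (g : Vec (Fin l) k) (f : Vec (Fin k) m) →
          IsIso e c g → IsIso d e f → IsIso d c (g ∘ᵥ f)
IsIso-∘ {d = d} {e} {c} g f (g-mor , g⁻¹ , g⁻¹-mor , g⁻¹g , gg⁻¹) (f-mor , f⁻¹ , f⁻¹-mor , f⁻¹f , ff⁻¹) =
  IsMor-∘ {d = d} {e} {c} g f g-mor f-mor , f⁻¹ ∘ᵥ g⁻¹ , IsMor-∘ {d = c} {e} {d} f⁻¹ g⁻¹ f⁻¹-mor g⁻¹-mor ,
  ∘ᵥ-inverse-∘ f⁻¹ g⁻¹ g f g⁻¹g f⁻¹f , ∘ᵥ-inverse-∘ g f f⁻¹ g⁻¹ ff⁻¹ gg⁻¹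

IsMor-id : (d : DP k) → IsMor d d (idᵥ k)
IsMor-id d =
  (λ i j p → subst₂ (P d) (sym (lookup-allFin i)) (sym (lookup-allFin j)) p) ,
  (λ i j q → subst₂ (Q d) (sym (lookup-allFin i)) (sym (lookup-allFin j)) q)

IsIso-id : (d : DP k) → IsIso d d (idᵥ k)
IsIso-id d = IsMor-id d , idᵥ _ , IsMor-id d , ∘ᵥ-identityˡ _ , ∘ᵥ-identityˡ _

IsIso-inverse : {d : DP m} {e : DP k} {f : Vec (Fin k) m} →
                (f-iso : IsIso d e f) → IsIso e d (proj₁ (proj₂ f-iso))
IsIso-inverse {f = f} (f-mor , _ , f⁻¹-mor , f⁻¹f , ff⁻¹) = f⁻¹-mor , f , f-mor , ff⁻¹ , f⁻¹f

≅-sym : {d : DP m} {e : DP k} → d ≅ e → e ≅ d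
≅-sym {d = d} {e} (_ , f-iso) = _ , IsIso-inverse {d = d} {e} f-iso

≅-trans : {d : DP m} {e : DP k} {c : DP l} → d ≅ e → e ≅ c → d ≅ c
≅-trans {d = d} {e} {c} (f , f-iso) (g , g-iso) = g ∘ᵥ f , IsIso-∘ {d = d} {e} {c} g f g-iso f-iso

≅⇒size≡ : {d : DP m} {e : DP k} → d ≅ e → m ≡ k
≅⇒size≡ (f , _ , f⁻¹ , _ , f⁻¹f , ff⁻¹) =
  ≤-antisym (injective⇒≤ (∘ᵥ-inverse⇒injective f⁻¹ f f⁻¹f)) (injective⇒≤ (∘ᵥ-inverse⇒injective f f⁻¹ ff⁻¹))

Epi-∘-iso : {d : DP m} {e : DP k} {c : DP l} {f : Vec (Fin k) m} {h : Vec (Fin l) k} →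
            Epi d e f → IsIso e c h → Epi d c (h ∘ᵥ f)
Epi-∘-iso {d = d} {e} {c} {f} {h} (f-mor , f-epi) (h-mor , h⁻¹ , _ , _ , hh⁻¹) =
  IsMor-∘ {d = d} {e} {c} h f h-mor f-mor , epi
  where
  epi : IsEpi d c (h ∘ᵥ f)
  epi b g g' g-mor g'-mor eq = ∘ᵥ-cancelʳ h h⁻¹ hh⁻¹
    (f-epi b (g ∘ᵥ h) (g' ∘ᵥ h)
      (IsMor-∘ {d = e} {c} {b} g h g-mor h-mor) (IsMor-∘ {d = e} {c} {b} g' h g'-mor h-mor)
      (trans (∘ᵥ-assoc g h f) (trans eq (sym (∘ᵥ-assoc g' h f)))))

ι-iso≡idᵥ : {σ τ f : Vec (Fin n) n} → IsIso (ι σ) (ι τ) f → f ≡ idᵥ n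
ι-iso≡idᵥ {f = f} ((f-mono , _) , f⁻¹ , (f⁻¹-mono , _) , f⁻¹f , _) = lookup-ext λ i →
  trans (<-mono-section⇒≗id (f-mono _ _) (f⁻¹-mono _ _) (∘ᵥ-inverse f⁻¹ f f⁻¹f) i)
        (sym (lookup-allFin i))

ι-iso-unique : {σ : Vec (Fin n) n} {e : DP k} {f g : Vec (Fin k) n} →
               IsIso (ι σ) e f → IsIso (ι σ) e g → f ≡ g
ι-iso-unique {σ = σ} {e} {f} {g} f-iso g-iso@(_ , g⁻¹ , _ , _ , gg⁻¹) = begin
  f                 ≡⟨ sym (∘ᵥ-identityˡ f) ⟩
  idᵥ _ ∘ᵥ f        ≡⟨ cong (_∘ᵥ f) (sym gg⁻¹) ⟩
  (g ∘ᵥ g⁻¹) ∘ᵥ f   ≡⟨ ∘ᵥ-assoc g g⁻¹ f ⟩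
  g ∘ᵥ (g⁻¹ ∘ᵥ f)   ≡⟨ cong (g ∘ᵥ_) (ι-iso≡idᵥ {σ = σ} {σ} g⁻¹∘f-iso) ⟩
  g ∘ᵥ idᵥ _        ≡⟨ ∘ᵥ-identityʳ g ⟩
  g                 ∎
  where
  open ≡-Reasoning
  g⁻¹∘f-iso : IsIso (ι σ) (ι σ) (g⁻¹ ∘ᵥ f)
  g⁻¹∘f-iso = IsIso-∘ {d = ι σ} {e} {ι σ} g⁻¹ f (IsIso-inverse {d = ι σ} {e} g-iso) f-iso

≅ι⇒Aut≡idᵥ : {σ : Vec (Fin n) n} {e : DP k} {x : Vec (Fin k) k} →
             ι σ ≅ e → Aut e x → x ≡ idᵥ k
≅ι⇒Aut≡idᵥ {σ = σ} {e} {x} (h , h-iso@(_ , h⁻¹ , _ , _ , hh⁻¹)) x-aut =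
  ∘ᵥ-cancelʳ h h⁻¹ hh⁻¹ (trans xh≡h (sym (∘ᵥ-identityˡ h)))
  where
  xh≡h : x ∘ᵥ h ≡ h
  xh≡h = ι-iso-unique {σ = σ} {e} {x ∘ᵥ h} {h} (IsIso-∘ {d = ι σ} {e} {e} x h x-aut h-iso) h-iso

ι-≅⇒order-preserving : {σ τ : Vec (Fin n) n} → ι σ ≅ ι τ →
                       ∀ i j → lookup σ i <ᶠ lookup σ j → lookup τ i <ᶠ lookup τ j
ι-≅⇒order-preserving {σ = σ} {τ} (_ , f-iso@((_ , f-Q) , _)) i j
  with refl ← ι-iso≡idᵥ {σ = σ} {τ} f-iso =
  subst₂ (λ u v → lookup τ u <ᶠ lookup τ v) (lookup-allFin i) (lookup-allFin j) ∘ f-Q i j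

IsPerm-order-injective : {σ τ : Vec (Fin n) n} → IsPerm (n , σ) → IsPerm (n , τ) →
  (∀ i j → lookup σ i <ᶠ lookup σ j → lookup τ i <ᶠ lookup τ j) →
  (∀ i j → lookup τ i <ᶠ lookup τ j → lookup σ i <ᶠ lookup σ j) → σ ≡ τ
IsPerm-order-injective {σ = σ} {τ} (σ⁻¹ , σ⁻¹σ , σσ⁻¹) (τ⁻¹ , τ⁻¹τ , ττ⁻¹) σ⇒τ τ⇒σ =
  lookup-ext λ i → begin
    lookup σ i                         ≡⟨ sym (τσ⁻¹≗id (lookup σ i)) ⟩
    lookup τ (lookup σ⁻¹ (lookup σ i))  ≡⟨ cong (lookup τ) (∘ᵥ-inverse σ⁻¹ σ σ⁻¹σ i) ⟩
    lookup τ i                         ∎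
  where
  open ≡-Reasoning
  relabel-mono : ∀ (α β α⁻¹ : Vec (Fin n) n) → α ∘ᵥ α⁻¹ ≡ idᵥ n →
                 (∀ i j → lookup α i <ᶠ lookup α j → lookup β i <ᶠ lookup β j) →
                 (λ u → lookup β (lookup α⁻¹ u)) Preserves _<ᶠ_ ⟶ _<ᶠ_
  relabel-mono α β α⁻¹ αα⁻¹ α⇒β {u} {v} =
    α⇒β _ _ ∘ subst₂ _<ᶠ_ (sym (∘ᵥ-inverse α α⁻¹ αα⁻¹ u)) (sym (∘ᵥ-inverse α α⁻¹ αα⁻¹ v))
  τσ⁻¹≗id : ∀ u → lookup τ (lookup σ⁻¹ u) ≡ u
  τσ⁻¹≗id = <-mono-section⇒≗id (relabel-mono σ τ σ⁻¹ σσ⁻¹ σ⇒τ) (relabel-mono τ σ τ⁻¹ ττ⁻¹ τ⇒σ)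
    (λ u → trans (cong (lookup σ) (∘ᵥ-inverse τ⁻¹ τ τ⁻¹τ _)) (∘ᵥ-inverse σ σ⁻¹ σσ⁻¹ u))

ι-≅-injective : {σ : Vec (Fin m) m} {τ : Vec (Fin n) n} → IsPerm (m , σ) → IsPerm (n , τ) →
                ι σ ≅ ι τ → _≡_ {A = Perm} (m , σ) (n , τ)
ι-≅-injective {σ = σ} {τ} σ-perm τ-perm σ≅τ with ≅⇒size≡ {d = ι σ} {ι τ} σ≅τ
... | refl = cong (_ ,_) (IsPerm-order-injective σ-perm τ-perm
               (ι-≅⇒order-preserving {σ = σ} {τ} σ≅τ)
               (ι-≅⇒order-preserving {σ = τ} {σ} (≅-sym {d = ι σ} {ι τ} σ≅τ)))

Card-Epi-resp-≅ : {d : DP m} {e : DP k} {c : DP l} {p q : ℕ} →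
                  Card (Epi d e) p → Card (Epi d c) q → e ≅ c → p ≡ q
Card-Epi-resp-≅ {d = d} {e} {c} #e #c (h , h-iso@(_ , h⁻¹ , _ , h⁻¹h , hh⁻¹)) = ≤-antisym
  (Card-injection⇒≤ #e #c (h ∘ᵥ_) (∘ᵥ-cancelˡ h h⁻¹ h⁻¹h) (λ f-epi → Epi-∘-iso {d = d} {e} {c} f-epi h-iso))
  (Card-injection⇒≤ #c #e (h⁻¹ ∘ᵥ_) (∘ᵥ-cancelˡ h⁻¹ h hh⁻¹)
    (λ f-epi → Epi-∘-iso {d = d} {c} {e} f-epi (IsIso-inverse {d = e} {c} h-iso)))

Card-Aut-≅ι : {σ : Vec (Fin n) n} {e : DP k} {p : ℕ} → Card (Aut e) p → ι σ ≅ e → p ≡ 1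
Card-Aut-≅ι {σ = σ} {e} #aut σ≅e = Card-singleton #aut (IsIso-id e) (≅ι⇒Aut≡idᵥ {σ = σ} {e} σ≅e)

indicatorRel : Set → Fin 3 → Fin 3 → Set
indicatorRel X fzero (fsuc fzero)        = X
indicatorRel X fzero (fsuc (fsuc fzero)) = ⊤
indicatorRel X _     _                   = ⊥

indicatorDP : Set → DP 3
indicatorDP X = record
  { P        = indicatorRel X
  ; Q        = λ _ _ → ⊥
  ; P-irrefl = λ { fzero () ; (fsuc _) () }
  ; P-trans  = λ { {fzero} {fsuc fzero} _ () ; {fzero} {fsuc (fsuc fzero)} _ () }
  ; Q-irrefl = λ _ ()
  ; Q-trans  = λ ()
  }

transposition₁₂ : Vec (Fin 3) 3
transposition₁₂ = fzero ∷ fsuc (fsuc fzero) ∷ fsuc fzero ∷ []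

transposition₁₂-Aut⇔ : (X : Set) → Aut (indicatorDP X) transposition₁₂ ⇔ X
transposition₁₂-Aut⇔ X = mk⇔ (λ ((swap-P , _) , _) → swap-P fzero (fsuc (fsuc fzero)) tt) swap-Aut
  where
  swap-Aut : X → Aut (indicatorDP X) transposition₁₂
  swap-Aut x = swap-mor , transposition₁₂ , swap-mor , refl , refl
    where
    swap-mor : IsMor (indicatorDP X) (indicatorDP X) transposition₁₂
    swap-mor = (λ { fzero (fsuc fzero) _ → tt ; fzero (fsuc (fsuc fzero)) _ → x }) , (λ _ _ ())

Card-Aut-indicator⇒Dec : {X : Set} → Card (Aut (indicatorDP X)) n → Dec X
Card-Aut-indicator⇒Dec {X = X} (auts , (_ , auts-enum) , _) =
  Dec.map (transposition₁₂-Aut⇔ X ⇔-∘ auts-enum transposition₁₂) (transposition₁₂ ∈? auts)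
  where open DecMembership (≡-dec _≟_)

lemma3p5 : ∀ {m} (d : DP m)
    (ep : ∀ {k} → DP k → ℕ) → (∀ {k} (d' : DP k) → Card (Epi d d') (ep d'))
    → (au : ∀ {k} → DP k → ℕ) → (∀ {k} (d' : DP k) → Card (Aut d') (au d'))
    → ∀ {k} (d' : DP k)
    → Σ[ L ∈ List Perm ]
        (Enumerates L (λ s → IsPerm s × (ι (proj₂ s) ≅ d'))
         × ProjCoeff d' (divℕ (ep d') (au d'))
             (fromℕ (sum (map (λ s → ep (ι (proj₂ s))) L))))
lemma3p5 d ep #epi au #aut d' with Card-Aut-indicator⇒Dec (#aut (indicatorDP (IsPermClass d')))
... | no ¬perm =
  [] , ([] , λ s → mk⇔ (λ ()) (λ s-perm → ⊥-elim (¬perm (s , s-perm)))) ,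
  (λ perm → ⊥-elim (¬perm perm)) , (λ _ → refl)
... | yes perm@((n₀ , σ₀) , σ₀-perm , σ₀≅d') =
  (n₀ , σ₀) ∷ [] , (All.[] ∷ [] , enum) , (λ _ → coeff) , (λ ¬perm → ⊥-elim (¬perm perm))
  where
  enum : ∀ s → s ∈ (n₀ , σ₀) ∷ [] ⇔ (IsPerm s × ι (proj₂ s) ≅ d')
  enum (_ , σ) = mk⇔ (λ { (here refl) → σ₀-perm , σ₀≅d' }) λ (σ-perm , σ≅d') →
    here (ι-≅-injective {σ = σ} {σ₀} σ-perm σ₀-perm
           (≅-trans {d = ι σ} {d'} {ι σ₀} σ≅d' (≅-sym {d = ι σ₀} {d'} σ₀≅d')))
  coeff : fromℕ (ep (ι σ₀) + 0) ≡ divℕ (ep d') (au d')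
  coeff rewrite +-identityʳ (ep (ι σ₀))
              | Card-Epi-resp-≅ {d = d} {ι σ₀} {d'} (#epi (ι σ₀)) (#epi d') σ₀≅d'
              | Card-Aut-≅ι {σ = σ₀} {d'} (#aut d') σ₀≅d' = refl
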